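{- Let $G=(V,E)$ be a finite graph, $k\in\mathbb{N}$, and $X,Y$ two $k$-heights of $G$. Then $\delta(X,Y):=\sum_{v\in V}|X(v)-Y(v)|$ is the smallest number of transitions of the up/down Markov chain $\mathcal{M}$ needed to get from state $X$ to state $Y$.
   Context: A $k$-height of $G$ is a map $\varphi:V\to\{0,\dots,k\}$ with $|\varphi(v)-\varphi(w)|\le 1$ for every edge $\{v,w\}\in E$. The up/down Markov chain $\mathcal{M}$ on the set of $k$-heights moves from $X_t$ as follows: choose $\tilde v\in V$, $\triangle\in\{ -1,+1\}$ and $p\in[0,1]$ uniformly at random; let $\varphi$ agree with $X_t$ except $\varphi(\tilde v)=X_t(\tilde v)+\triangle$; if $\varphi$ is a $k$-height and $p\le1/2$ then $X_{t+1}=\varphi$, else $X_{t+1}=X_t$. Thus a (non-trivial) transition changes the value at a single vertex by $\pm1$ while remaining a $k$-height. -}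

module Defs where

open import Data.Nat using (ℕ; zero; suc; _+_; _≤_; ∣_-_∣)
open import Data.Fin using (Fin)
open import Data.Product using (Σ; _×_; _,_)
open import Data.Sum using (_⊎_)
open import Relation.Binary.PropositionalEquality using (_≡_; _≢_)
open import Relation.Nullary using (¬_)

record Graph : Set₁ where
  field
    n     : ℕ
    Adj   : Fin n → Fin n → Set
    sym   : ∀ {v w} → Adj v w → Adj w v
    irrefl : ∀ {v} → ¬ Adj v v

open Graph public

Labelling : Graph → Set
Labelling G = Fin (n G) → ℕ

IsKHeight : (G : Graph) → ℕ → Labelling G → Set
IsKHeight G k φ =
  (∀ v → φ v ≤ k) × (∀ v w → Adj G v w → ∣ φ v - φ w ∣ ≤ 1)

sumFin : (m : ℕ) → (Fin m → ℕ) → ℕ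
sumFin zero    f = 0
sumFin (suc m) f = f Fin.zero + sumFin m (λ i → f (Fin.suc i))

δ : (G : Graph) → Labelling G → Labelling G → ℕ
δ G X Y = sumFin (n G) (λ v → ∣ X v - Y v ∣)

-- A (non-trivial) transition of the up/down chain M from X to Y:
-- Y is a k-height that differs from X by ±1 at a single vertex ṽ and agrees elsewhere.
Transition : (G : Graph) (k : ℕ) → Labelling G → Labelling G → Set
Transition G k X Y =
  IsKHeight G k Y ×
  Σ (Fin (n G)) λ ṽ →
    ((Y ṽ ≡ suc (X ṽ)) ⊎ (X ṽ ≡ suc (Y ṽ))) ×
    (∀ w → w ≢ ṽ → Y w ≡ X w)

-- Reaches G k m X Y : Y can be reached from X by exactly m transitions of M.
-- (Labellings are compared pointwise at the end, so no function extensionality is needed.)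
data Reaches (G : Graph) (k : ℕ) : ℕ → Labelling G → Labelling G → Set where
  done : ∀ {X Y} → (∀ v → X v ≡ Y v) → Reaches G k zero X Y
  step : ∀ {m X Z Y} → Transition G k X Z → Reaches G k m Z Y → Reaches G k (suc m) X Y

{-# OPTIONS --safe #-}
-- A transition moves one value by one, so by the triangle inequality it changes δ(·, Y) by at
-- most one; hence δ(X, Y) transitions are needed. They also suffice: if Y(v) < X(v) somewhere,
-- lower X by one at a vertex u maximising X among such vertices. A neighbour b with
-- X(b) > X(u) would either have Y(b) < X(b), contradicting maximality, or
-- Y(b) ≥ X(b) ≥ Y(u) + 2, contradicting that Y is a height; so the result is again a k-height,
-- one step closer to Y. If instead X ≤ Y, do the same from Y towards X and reverse the step.
module Submission where

open import Data.Fin using (Fin; zero; suc; _≟_; punchIn)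
open import Data.Fin.Properties using (punchInᵢ≢i; ¬∀⟶∃¬)
open import Data.List using (filter; allFin)
open import Data.List.Extrema.Nat using (argmax; argmax-all; f[xs]≤f[argmax])
open import Data.List.Membership.Propositional.Properties using (∈-filter⁺; ∈-allFin)
import Data.List.Relation.Unary.All as All
open import Data.List.Relation.Unary.All.Properties using (all-filter)
open import Data.Nat using (ℕ; zero; suc; pred; _+_; _≤_; _<_; ∣_-_∣; NonZero; z≤n; s≤s; s≤s⁻¹)
import Data.Nat as ℕ
open import Data.Nat.Properties
  using ( n≤1+n; ≤-reflexive; ≤-trans; <-cmp; ≮⇒≥; m≤n⇒m≤1+n; pred[n]≤n
        ; +-monoˡ-≤; m+n≡0⇒m≡0; suc-pred; suc-injective; 0≢1+n; m<n⇒0<n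
        ; ∣-∣-comm; ∣-∣-identityʳ; ∣-∣-triangle; m≤∣m-n∣+n; m≡n⇒∣m-n∣≡0; ∣m-n∣≡0⇒m≡n
        ; m≤n⇒∣m-n∣≡n∸m; m+n∸n≡m; +-0-commutativeMonoid; module ≤-Reasoning)
open import Data.Product using (_×_; _,_; ∃; proj₁)
open import Data.Sum using (_⊎_; inj₁; inj₂; swap) renaming (map to ⊎-map)
open import Data.Vec.Functional using (Vector; removeAt; updateAt)
open import Data.Vec.Functional.Properties using (updateAt-updates; updateAt-minimal)
open import Function using (_∘_)
open import Relation.Binary.Definitions using (tri<; tri≈; tri>)
open import Relation.Binary.PropositionalEquality
open import Relation.Nullary using (yes; no; contradiction)
open import Relation.Unary using (Pred; Decidable)

open import Algebra.Properties.CommutativeMonoid.Sum +-0-commutativeMonoid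
  using (sum; sum-remove; sum-cong-≗; sum-replicate-zero)

open import Defs hiding (sym)

∃-argmax : ∀ {m p} {P : Pred (Fin m) p} → Decidable P → (f : Fin m → ℕ) → ∀ {i} → P i →
           ∃ λ j → P j × (∀ l → P l → f l ≤ f j)
∃-argmax {m} {P = P} P? f {i} Pi = j , argmax-all f Pi (all-filter P? (allFin m)) , j-maximal
  where
  candidates = filter P? (allFin m)
  j = argmax f i candidates
  j-maximal : ∀ l → P l → f l ≤ f j
  j-maximal l Pl = All.lookup (f[xs]≤f[argmax] {f = f} i candidates) (∈-filter⁺ P? (∈-allFin l) Pl)

sumFin≡sum : ∀ m (f : Vector ℕ m) → sumFin m f ≡ sum f
sumFin≡sum zero    f = refl
sumFin≡sum (suc m) f = cong (f zero +_) (sumFin≡sum m (f ∘ suc))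

sumFin-cong : ∀ {m} {f g : Vector ℕ m} → f ≗ g → sumFin m f ≡ sumFin m g
sumFin-cong {m} {f} {g} f≗g =
  trans (sumFin≡sum m f) (trans (sum-cong-≗ f≗g) (sym (sumFin≡sum m g)))

sumFin≡0⇒≗0 : ∀ {m} (f : Vector ℕ m) → sumFin m f ≡ 0 → ∀ i → f i ≡ 0
sumFin≡0⇒≗0 {suc m} f sum≡0 i =
  m+n≡0⇒m≡0 (f i) (trans (sym (sum-remove {i = i} f)) (trans (sym (sumFin≡sum _ f)) sum≡0))

≗0⇒sumFin≡0 : ∀ {m} (f : Vector ℕ m) → (∀ i → f i ≡ 0) → sumFin m f ≡ 0
≗0⇒sumFin≡0 {m} f f≗0 = trans (sumFin≡sum m f) (trans (sum-cong-≗ f≗0) (sum-replicate-zero m))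

sumFin-split-at : ∀ {m} {f g : Vector ℕ m} i → (∀ j → j ≢ i → f j ≡ g j) →
                  ∃ λ r → sumFin m f ≡ f i + r × sumFin m g ≡ g i + r
sumFin-split-at {suc m} {f} {g} i f≗g =
  sum (removeAt f i) ,
  trans (sumFin≡sum _ f) (sum-remove f) ,
  trans (sumFin≡sum _ g) (trans (sum-remove g) (cong (g i +_) (sym removeAt-agree)))
  where
  removeAt-agree : sum (removeAt f i) ≡ sum (removeAt g i)
  removeAt-agree = sum-cong-≗ (λ j → f≗g (punchIn i j) (punchInᵢ≢i i j))

∣m-n∣≤1⇒m≤1+n : ∀ m n → ∣ m - n ∣ ≤ 1 → m ≤ suc n
∣m-n∣≤1⇒m≤1+n m n ∣m-n∣≤1 = ≤-trans (m≤∣m-n∣+n m n) (+-monoˡ-≤ n ∣m-n∣≤1)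

m≤1+n⇒n≤1+m⇒∣m-n∣≤1 : ∀ {m n} → m ≤ suc n → n ≤ suc m → ∣ m - n ∣ ≤ 1
m≤1+n⇒n≤1+m⇒∣m-n∣≤1 {zero}  {zero}  _         _         = z≤n
m≤1+n⇒n≤1+m⇒∣m-n∣≤1 {zero}  {suc n} _         n≤1       = n≤1
m≤1+n⇒n≤1+m⇒∣m-n∣≤1 {suc m} {zero}  m≤1       _         = m≤1
m≤1+n⇒n≤1+m⇒∣m-n∣≤1 {suc m} {suc n} (s≤s m≤n) (s≤s n≤m) = m≤1+n⇒n≤1+m⇒∣m-n∣≤1 m≤n n≤m

∣pred[m]-n∣≤1 : ∀ {m n} → n ≤ m → ∣ m - n ∣ ≤ 1 → ∣ pred m - n ∣ ≤ 1
∣pred[m]-n∣≤1 {zero}      z≤n   _         = z≤n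
∣pred[m]-n∣≤1 {suc m} {n} n≤1+m ∣1+m-n∣≤1 =
  m≤1+n⇒n≤1+m⇒∣m-n∣≤1 (m≤n⇒m≤1+n (s≤s⁻¹ (∣m-n∣≤1⇒m≤1+n (suc m) n ∣1+m-n∣≤1))) n≤1+m

∣m-n∣≡1+∣pred[m]-n∣ : ∀ {m n} → n < m → ∣ m - n ∣ ≡ suc ∣ pred m - n ∣
∣m-n∣≡1+∣pred[m]-n∣ {suc m}       {zero}  _           = cong suc (sym (∣-∣-identityʳ m))
∣m-n∣≡1+∣pred[m]-n∣ {suc (suc m)} {suc n} (s≤s n<1+m) = ∣m-n∣≡1+∣pred[m]-n∣ n<1+m

∣m-n∣≡1 : ∀ {m n} → (n ≡ suc m) ⊎ (m ≡ suc n) → ∣ m - n ∣ ≡ 1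
∣m-n∣≡1 {m} (inj₁ refl) = trans (m≤n⇒∣m-n∣≡n∸m (n≤1+n m)) (m+n∸n≡m 1 m)
∣m-n∣≡1 {n = n} (inj₂ refl) = trans (∣-∣-comm (suc n) n) (∣m-n∣≡1 {n} (inj₁ refl))

module _ (G : Graph) (k : ℕ) where

  δ-comm : ∀ X Y → δ G X Y ≡ δ G Y X
  δ-comm X Y = sumFin-cong (λ v → ∣-∣-comm (X v) (Y v))

  δ≡0⇒≗ : ∀ {X Y} → δ G X Y ≡ 0 → X ≗ Y
  δ≡0⇒≗ δ≡0 v = ∣m-n∣≡0⇒m≡n (sumFin≡0⇒≗0 _ δ≡0 v)

  ≗⇒δ≡0 : ∀ {X Y} → X ≗ Y → δ G X Y ≡ 0
  ≗⇒δ≡0 X≗Y = ≗0⇒sumFin≡0 _ (λ v → m≡n⇒∣m-n∣≡0 (X≗Y v))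

  δ-transition : ∀ {X Z Y} → Transition G k X Z → δ G X Y ≤ suc (δ G Z Y)
  δ-transition {X} {Z} {Y} (_ , v , Xv~Zv , Z≗X)
    with sumFin-split-at v (λ w w≢v → cong (λ x → ∣ x - Y w ∣) (sym (Z≗X w w≢v)))
  ... | r , δXY≡ , δZY≡ = begin
    δ G X Y                           ≡⟨ δXY≡ ⟩
    ∣ X v - Y v ∣ + r                 ≤⟨ +-monoˡ-≤ r (∣-∣-triangle (X v) (Z v) (Y v)) ⟩
    ∣ X v - Z v ∣ + ∣ Z v - Y v ∣ + r ≡⟨ cong (λ d → d + ∣ Z v - Y v ∣ + r) (∣m-n∣≡1 Xv~Zv) ⟩
    suc (∣ Z v - Y v ∣ + r)           ≡⟨ cong suc δZY≡ ⟨
    suc (δ G Z Y)                     ∎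
    where open ≤-Reasoning

  isKHeight-local : ∀ {X Z u} → IsKHeight G k X → (∀ w → w ≢ u → Z w ≡ X w) → Z u ≤ k →
                    (∀ b → Adj G u b → ∣ Z u - X b ∣ ≤ 1) → IsKHeight G k Z
  isKHeight-local {X} {Z} {u} (X≤k , X-lip) Z≗X Zu≤k Zu-lip = Z≤k , Z-lip
    where
    Z≤k : ∀ w → Z w ≤ k
    Z≤k w with w ≟ u
    ... | yes refl = Zu≤k
    ... | no w≢u rewrite Z≗X w w≢u = X≤k w
    Z-lip : ∀ a b → Adj G a b → ∣ Z a - Z b ∣ ≤ 1
    Z-lip a b a~b with a ≟ u | b ≟ u
    ... | yes refl | yes refl = contradiction a~b (irrefl G)
    ... | yes refl | no b≢u rewrite Z≗X b b≢u = Zu-lip b a~b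
    ... | no a≢u | yes refl rewrite Z≗X a a≢u | ∣-∣-comm (X a) (Z b) = Zu-lip a (Graph.sym G a~b)
    ... | no a≢u | no b≢u rewrite Z≗X a a≢u | Z≗X b b≢u = X-lip a b a~b

  lower : Labelling G → Fin (n G) → Labelling G
  lower X u = updateAt X u pred

  lower-at : ∀ X u → lower X u u ≡ pred (X u)
  lower-at X u = updateAt-updates u X

  lower-off : ∀ X u w → w ≢ u → lower X u w ≡ X w
  lower-off X u w w≢u = updateAt-minimal w u X w≢u

  lower-transition : ∀ {X u} → IsKHeight G k X → .{{NonZero (X u)}} →
                     (∀ b → Adj G u b → X b ≤ X u) → Transition G k X (lower X u)
  lower-transition {X} {u} X-height@(X≤k , X-lip) nbrs≤ =
    isKHeight-local X-height (lower-off X u) Zu≤k Zu-lip ,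
    u , inj₂ (trans (sym (suc-pred (X u))) (cong suc (sym (lower-at X u)))) , lower-off X u
    where
    Zu≤k : lower X u u ≤ k
    Zu≤k rewrite lower-at X u = ≤-trans pred[n]≤n (X≤k u)
    Zu-lip : ∀ b → Adj G u b → ∣ lower X u u - X b ∣ ≤ 1
    Zu-lip b u~b rewrite lower-at X u = ∣pred[m]-n∣≤1 (nbrs≤ b u~b) (X-lip u b u~b)

  δ-lower : ∀ {X Y u} → Y u < X u → δ G X Y ≡ suc (δ G (lower X u) Y)
  δ-lower {X} {Y} {u} Yu<Xu
    with sumFin-split-at u (λ w w≢u → cong (λ x → ∣ x - Y w ∣) (sym (lower-off X u w w≢u)))
  ... | r , δXY≡ , δZY≡ = begin
    δ G X Y                         ≡⟨ δXY≡ ⟩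
    ∣ X u - Y u ∣ + r               ≡⟨ cong (_+ r) (∣m-n∣≡1+∣pred[m]-n∣ Yu<Xu) ⟩
    suc (∣ pred (X u) - Y u ∣ + r)  ≡⟨ cong (λ x → suc (∣ x - Y u ∣ + r)) (lower-at X u) ⟨
    suc (∣ lower X u u - Y u ∣ + r) ≡⟨ cong suc δZY≡ ⟨
    suc (δ G (lower X u) Y)         ∎
    where open ≡-Reasoning

  descent : ∀ {X Y v} → IsKHeight G k X → IsKHeight G k Y → Y v < X v →
            ∃ λ Z → Transition G k X Z × δ G X Y ≡ suc (δ G Z Y)
  descent {X} {Y} X-height (_ , Y-lip) Yv<Xv
    with ∃-argmax (λ w → Y w ℕ.<? X w) X Yv<Xv
  ... | u , Yu<Xu , maximal =
    lower X u , lower-transition X-height {{ℕ.>-nonZero (m<n⇒0<n Yu<Xu)}} nbrs≤ ,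
    δ-lower Yu<Xu
    where
    nbrs≤ : ∀ b → Adj G u b → X b ≤ X u
    nbrs≤ b u~b with Y b ℕ.<? X b
    ... | yes Yb<Xb = maximal b Yb<Xb
    ... | no Yb≮Xb = begin
      X b       ≤⟨ ≮⇒≥ Yb≮Xb ⟩
      Y b       ≤⟨ ∣m-n∣≤1⇒m≤1+n (Y b) (Y u) (Y-lip b u (Graph.sym G u~b)) ⟩
      suc (Y u) ≤⟨ Yu<Xu ⟩
      X u       ∎
      where open ≤-Reasoning

  Transition-sym : ∀ {X Z} → IsKHeight G k X → Transition G k X Z → Transition G k Z X
  Transition-sym X-height (_ , v , Xv~Zv , Z≗X) =
    X-height , v , swap Xv~Zv , λ w w≢v → sym (Z≗X w w≢v)

  Transition-respˡ : ∀ {X X′ Z} → X ≗ X′ → Transition G k X′ Z → Transition G k X Z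
  Transition-respˡ X≗X′ (Z-height , v , X′v~Zv , Z≗X′) =
    Z-height , v ,
    ⊎-map (λ Zv≡ → trans Zv≡ (cong suc (sym (X≗X′ v)))) (trans (X≗X′ v)) X′v~Zv ,
    λ w w≢v → trans (Z≗X′ w w≢v) (sym (X≗X′ w))

  Reaches-snoc : ∀ {m X Y Z} → Reaches G k m X Y → Transition G k Y Z → Reaches G k (suc m) X Z
  Reaches-snoc (done X≗Y)      Y→Z = step (Transition-respˡ X≗Y Y→Z) (done (λ _ → refl))
  Reaches-snoc (step X→W W⇝Y) Y→Z = step X→W (Reaches-snoc W⇝Y Y→Z)

  δ≤length : ∀ {m X Y} → Reaches G k m X Y → δ G X Y ≤ m
  δ≤length (done X≗Y)      = ≤-reflexive (≗⇒δ≡0 X≗Y)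
  δ≤length (step X→Z Z⇝Y) = ≤-trans (δ-transition X→Z) (s≤s (δ≤length Z⇝Y))

  reaches-δ : ∀ d {X Y} → IsKHeight G k X → IsKHeight G k Y → δ G X Y ≡ d → Reaches G k d X Y
  reaches-δ zero    _ _ δ≡0 = done (δ≡0⇒≗ δ≡0)
  reaches-δ (suc d) {X} {Y} X-height Y-height δ≡1+d
    with ¬∀⟶∃¬ (n G) _ (λ v → X v ℕ.≟ Y v) (λ X≗Y → 0≢1+n (trans (sym (≗⇒δ≡0 X≗Y)) δ≡1+d))
  ... | v , Xv≢Yv with <-cmp (X v) (Y v)
  ... | tri≈ _ Xv≡Yv _ = contradiction Xv≡Yv Xv≢Yv
  ... | tri> _ _ Yv<Xv with descent X-height Y-height Yv<Xv
  ...   | Z , X→Z , δXY≡ =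
    step X→Z (reaches-δ d (proj₁ X→Z) Y-height (suc-injective (trans (sym δXY≡) δ≡1+d)))
  reaches-δ (suc d) {X} {Y} X-height Y-height δ≡1+d
    | v , _ | tri< Xv<Yv _ _ with descent Y-height X-height Xv<Yv
  ...   | Z , Y→Z , δYX≡ =
    Reaches-snoc (reaches-δ d X-height (proj₁ Y→Z) (suc-injective δXZ≡1+d)) (Transition-sym Y-height Y→Z)
    where
    open ≡-Reasoning
    δXZ≡1+d : suc (δ G X Z) ≡ suc d
    δXZ≡1+d = begin
      suc (δ G X Z) ≡⟨ cong suc (δ-comm X Z) ⟩
      suc (δ G Z X) ≡⟨ δYX≡ ⟨
      δ G Y X       ≡⟨ δ-comm Y X ⟩
      δ G X Y       ≡⟨ δ≡1+d ⟩
      suc d         ∎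

lemma6 : (G : Graph) (k : ℕ) (X Y : Labelling G) →
    IsKHeight G k X → IsKHeight G k Y →
    Reaches G k (δ G X Y) X Y × (∀ m → Reaches G k m X Y → δ G X Y ≤ m)
lemma6 G k X Y X-height Y-height =
  reaches-δ G k (δ G X Y) X-height Y-height refl , λ _ → δ≤length G k
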